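{- Let $\mathbf{A}$ be a composition of operators from $\{\mathbf{S},\mathbf{R}\}$. If $\mathbf{A}$ respects $P$, then $\mathbf{A}\circ\mathbf{S}$ respects $P$.
   Context: Notation and conventions. - Permutations of $[n]$ are in one-line notation, with composition $(\lambda\circ\sigma)(i)=\lambda(\sigma(i))$. - A sequence of distinct integers is identified with the permutation order-isomorphic to it. - $\mathrm{Av}(231)$ (resp. $\mathrm{Av}(132)$) is the set of permutations avoiding $231$ (resp. $132$). Operators. - $\mathbf{S}(\varepsilon)=\varepsilon$ and $\mathbf{S}(\alpha n\beta)=\mathbf{S}(\alpha)\mathbf{S}(\beta)n$, where $n$ is the maximum entry. - $\mathbf{R}$ is reversal. The bijection $P$. - $\alpha\oplus\beta=\alpha(\beta+|\alpha|)$ and $\alpha\ominus\beta=(\alpha+|\beta|)\beta$. - $P:\mathrm{Av}(231)\to\mathrm{Av}(132)$ is defined by $P(\varepsilon)=\varepsilon$ and $P(\alpha\oplus(1\ominus\beta))=(P(\alpha)\oplus1)\ominus P(\beta)$, using the unique decomposition of nonempty $231$-avoiders. - For $\pi\in\mathrm{Av}(231)$ of size $n$, $\lambda_\pi$ is the permutation of $[n]$ with $P(\pi)=\lambda_\pi\circ\pi$. Trees. - A binary tree is decreasing if every child's label is smaller than its parent's. - The in-order reading is (left subtree reading)(root)(right subtree reading). - $\mathrm{T}_{\mathrm{in}}(\pi)$ is the unique decreasing binary tree with in-order reading $\pi$. - $\lambda(T)$ denotes $T$ with every label $\ell$ replaced by $\lambda(\ell)$. Respecting $P$. An operator $\mathbf{A}$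 respects $P$ if, for every $n$ and every $\pi\in\mathrm{Av}(231)$ of size $n$ lying in the image of $\mathbf{A}$: - (i) every $\theta$ with $\mathbf{A}(\theta)=\pi$ satisfies $\mathbf{A}(\lambda_\pi\circ\theta)=P(\pi)$ and $\mathrm{T}_{\mathrm{in}}(\lambda_\pi\circ\theta)=\lambda_\pi(\mathrm{T}_{\mathrm{in}}(\theta))$; - (ii) $\theta\mapsto\lambda_\pi\circ\theta$ is a bijection from $\mathbf{A}^{ -1}(\pi)$ onto $\mathbf{A}^{ -1}(P(\pi))$. -}

module Defs where

open import Data.Nat using (ℕ; zero; suc; _+_; _∸_; _<_; _⊔_; _≟_)
open import Data.List using (List; []; _∷_; _++_; map; length; upTo; [_])
open import Data.List.Relation.Binary.Permutation.Propositional using (_↭_)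
open import Data.List.Relation.Binary.Sublist.Propositional using (_⊆_)
open import Data.Product using (Σ; _×_; _,_; ∃)
open import Function.Bundles using (_⇔_)
open import Relation.Nullary using (¬_; yes; no)
open import Relation.Binary.PropositionalEquality using (_≡_)

[1‥_] : ℕ → List ℕ
[1‥ n ] = map suc (upTo n)

-- π is a permutation of [n] in one-line notation
IsPerm : ℕ → List ℕ → Set
IsPerm n π = π ↭ [1‥ n ]

-- 0-based entry access (default 0 out of range)
at : List ℕ → ℕ → ℕ
at []       _       = 0
at (x ∷ xs) zero    = x
at (x ∷ xs) (suc i) = at xs i

-- λ as a function on [n]: λ(j) = j-th entry (1-based)
app : List ℕ → ℕ → ℕ
app λ′ j = at λ′ (j ∸ 1)

_∘ₚ_ : List ℕ → List ℕ → List ℕ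
λ′ ∘ₚ σ = map (app λ′) σ

OrderIso : List ℕ → List ℕ → Set
OrderIso s p = length s ≡ length p ×
  (∀ i j → i < length s → j < length s → (at s i < at s j) ⇔ (at p i < at p j))

Contains : List ℕ → List ℕ → Set
Contains p π = Σ (List ℕ) λ s → s ⊆ π × OrderIso s p

Avoids : List ℕ → List ℕ → Set
Avoids p π = ¬ Contains p π

Av231 : List ℕ → Set
Av231 = Avoids (2 ∷ 3 ∷ 1 ∷ [])

maxL : List ℕ → ℕ
maxL []       = 0
maxL (x ∷ xs) = x ⊔ maxL xs

breakAt : ℕ → List ℕ → List ℕ × List ℕ
breakAt m [] = [] , []
breakAt m (x ∷ xs) with x ≟ m
... | yes _ = [] , xs
... | no  _ with breakAt m xs
...   | (a , b) = (x ∷ a) , b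

-- fuel-based; fuel = length suffices (both parts are strictly shorter)
S′ : ℕ → List ℕ → List ℕ
S′ zero     xs = xs
S′ (suc f)  [] = []
S′ (suc f)  (x ∷ xs) with breakAt (maxL (x ∷ xs)) (x ∷ xs)
... | (α , β) = S′ f α ++ S′ f β ++ [ maxL (x ∷ xs) ]

S : List ℕ → List ℕ
S xs = S′ (length xs) xs

R : List ℕ → List ℕ
R = Data.List.reverse

data Op : Set where
  opS opR : Op

⟦_⟧ₒ : Op → List ℕ → List ℕ
⟦ opS ⟧ₒ = S
⟦ opR ⟧ₒ = R

⟦_⟧ : List Op → List ℕ → List ℕ
⟦ [] ⟧     θ = θ
⟦ o ∷ w ⟧  θ = ⟦ o ⟧ₒ (⟦ w ⟧ θ)

_⊕_ : List ℕ → List ℕ → List ℕ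
α ⊕ β = α ++ map (_+ length α) β

_⊖_ : List ℕ → List ℕ → List ℕ
α ⊖ β = map (_+ length β) α ++ β

-- PGraph π ρ  means  ρ = P(π):
-- P(ε) = ε,  P(α ⊕ (1 ⊖ β)) = (P(α) ⊕ 1) ⊖ P(β)
data PGraph : List ℕ → List ℕ → Set where
  pε    : PGraph [] []
  pstep : ∀ {α α′ β β′} → PGraph α α′ → PGraph β β′ →
          PGraph (α ⊕ ([ 1 ] ⊖ β)) ((α′ ⊕ [ 1 ]) ⊖ β′)

data Tree : Set where
  leaf : Tree
  node : Tree → ℕ → Tree → Tree

Tin′ : ℕ → List ℕ → Tree
Tin′ zero    _  = leaf
Tin′ (suc f) [] = leaf
Tin′ (suc f) (x ∷ xs) with breakAt (maxL (x ∷ xs)) (x ∷ xs)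
... | (α , β) = node (Tin′ f α) (maxL (x ∷ xs)) (Tin′ f β)

Tin : List ℕ → Tree
Tin π = Tin′ (length π) π

relabel : List ℕ → Tree → Tree
relabel λ′ leaf         = leaf
relabel λ′ (node l x r) = node (relabel λ′ l) (app λ′ x) (relabel λ′ r)

-- w respects P at π, where ρ = P(π) and λ = λ_π (ρ = λ ∘ π)
RespectsAt : List Op → ℕ → List ℕ → List ℕ → List ℕ → Set
RespectsAt w n π ρ λ′ =
  (∀ θ → IsPerm n θ → ⟦ w ⟧ θ ≡ π →
      ⟦ w ⟧ (λ′ ∘ₚ θ) ≡ ρ × Tin (λ′ ∘ₚ θ) ≡ relabel λ′ (Tin θ))
  -- (ii) θ ↦ λ∘θ is a bijection A⁻¹(π) → A⁻¹(P(π))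
  × (∀ θ → IsPerm n θ → ⟦ w ⟧ θ ≡ π → IsPerm n (λ′ ∘ₚ θ) × ⟦ w ⟧ (λ′ ∘ₚ θ) ≡ ρ)
  × (∀ θ₁ θ₂ → IsPerm n θ₁ → ⟦ w ⟧ θ₁ ≡ π → IsPerm n θ₂ → ⟦ w ⟧ θ₂ ≡ π →
        λ′ ∘ₚ θ₁ ≡ λ′ ∘ₚ θ₂ → θ₁ ≡ θ₂)
  × (∀ θ′ → IsPerm n θ′ → ⟦ w ⟧ θ′ ≡ ρ →
        Σ (List ℕ) λ θ → IsPerm n θ × ⟦ w ⟧ θ ≡ π × λ′ ∘ₚ θ ≡ θ′)

Respects : List Op → Set
Respects w = ∀ n π → IsPerm n π → Av231 π →
  (Σ (List ℕ) λ θ → IsPerm n θ × ⟦ w ⟧ θ ≡ π) →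
  ∀ ρ → PGraph π ρ →
  ∀ λ′ → IsPerm n λ′ → λ′ ∘ₚ π ≡ ρ →
  RespectsAt w n π ρ λ′

module Submission where

-- S θ is the postorder reading of the decreasing tree T_in(θ).  Call l decreasing under f when
-- relabelling T_in(l) by f keeps it decreasing; this passes to both factors of l = u ++ v.
-- In T_in(post T) the root of T lies above T_in(post l ++ post r), so if S θ = post (T_in θ) is
-- decreasing under f, this propagates down T_in(θ): f(T_in θ) is decreasing, hence it is
-- T_in(f ∘ θ), and then S(f ∘ θ) = f ∘ S θ.  Condition (i) for A ∘ S is this with f = λ, fed by
-- (i) for A at S θ; surjectivity in (ii) is the same argument with f = λ⁻¹ at the A-preimage
-- σ = λ⁻¹ ∘ S θ′ supplied by A.

open import Defs
open import Relation.Binary.PropositionalEquality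
  using (_≡_; _≢_; refl; sym; trans; cong; cong₂; subst; subst₂; setoid; module ≡-Reasoning)
open import Data.Nat using (ℕ; zero; suc; _≤_; _<_; _⊔_; _≟_; z≤n; s≤s)
open import Data.Nat.Properties
  using (≤-trans; ≤-refl; <⇒≤; <⇒≢; ≤∧≢⇒<; m≤m⊔n; m≤n⊔m; ⊔-lub; ⊔-sel; ⊔-identityʳ;
         m≤n⇒m⊔n≡n; m≥n⇒m⊔n≡m; +-suc; m+n≤o⇒m≤o; m+n≤o⇒n≤o; suc-injective)
open import Data.List using (List; []; _∷_; _++_; [_]; map; length; upTo; applyUpTo)
open import Data.List.Properties
  using (length-++; length-map; length-upTo; map-++; map-∘; map-id-local; map-upTo; ++-assoc; ∷-injective)
open import Data.List.Relation.Unary.All using (All; []; _∷_)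
import Data.List.Relation.Unary.All as All
import Data.List.Relation.Unary.All.Properties as AllP
open import Data.List.Relation.Unary.Any using (here; there)
open import Data.List.Membership.Propositional using (_∈_)
open import Data.List.Membership.Propositional.Properties using (∈-map⁻; ∈-upTo⁻)
open import Data.Product using (Σ; ∃; ∃₂; _×_; _,_; proj₁; proj₂)
open import Data.Sum using (_⊎_; inj₁; inj₂)
open import Data.Empty using (⊥-elim)
open import Data.Unit using (⊤; tt)
open import Function using (_∘_; _⇔_; mk⇔; Equivalence)
open import Data.List.Relation.Unary.AllPairs using ([]; _∷_)
open import Data.List.Relation.Unary.Unique.Propositional using (Unique)
import Data.List.Relation.Unary.Unique.Propositional.Properties as UP
open import Data.List.Relation.Binary.Permutation.Propositional
  using (_↭_; ↭-refl; ↭-sym; ↭-trans; ↭-reflexive; ↭⇒↭ₛ)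
open import Data.List.Relation.Binary.Permutation.Setoid.Properties (setoid ℕ) using (Unique-resp-↭)
import Data.List.Relation.Binary.Permutation.Propositional.Properties as PP
open import Relation.Nullary using (yes; no)

maxL-upper : ∀ l → All (_≤ maxL l) l
maxL-upper []       = []
maxL-upper (x ∷ xs) =
  m≤m⊔n x (maxL xs) ∷ All.map (λ y≤ → ≤-trans y≤ (m≤n⊔m x (maxL xs))) (maxL-upper xs)

maxL-least : ∀ {m} l → All (_≤ m) l → maxL l ≤ m
maxL-least []       []           = z≤n
maxL-least (x ∷ xs) (x≤m ∷ xs≤m) = ⊔-lub x≤m (maxL-least xs xs≤m)

maxL-∈ : ∀ x xs → maxL (x ∷ xs) ∈ x ∷ xs
maxL-∈ x []       = here (⊔-identityʳ x)
maxL-∈ x (y ∷ ys) with ⊔-sel x (maxL (y ∷ ys))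
... | inj₁ max≡x = here max≡x
... | inj₂ max≡ = there (subst (_∈ y ∷ ys) (sym max≡) (maxL-∈ y ys))

maxL-split : ∀ {m} α β → All (_< m) α → All (_≤ m) β → maxL (α ++ m ∷ β) ≡ m
maxL-split []      β _           β≤m = m≥n⇒m⊔n≡m (maxL-least β β≤m)
maxL-split (x ∷ α) β (x<m ∷ α<m) β≤m =
  trans (cong (x ⊔_) (maxL-split α β α<m β≤m)) (m≤n⇒m⊔n≡n (<⇒≤ x<m))

breakAt-split : ∀ {m} α β → All (_≢ m) α → breakAt m (α ++ m ∷ β) ≡ (α , β)
breakAt-split {m} [] β [] with m ≟ m
... | yes _   = refl
... | no m≢m = ⊥-elim (m≢m refl)
breakAt-split {m} (x ∷ α) β (x≢m ∷ α≢m) with x ≟ m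
... | yes x≡m = ⊥-elim (x≢m x≡m)
... | no _ rewrite breakAt-split α β α≢m = refl

split-at-max : ∀ {m} l → m ∈ l → All (_≤ m) l →
  ∃₂ λ (α β : List ℕ) → l ≡ α ++ m ∷ β × All (_< m) α × All (_≤ m) β
split-at-max {m} (x ∷ xs) _ (x≤m ∷ xs≤m) with x ≟ m
... | yes refl = [] , xs , refl , [] , xs≤m
split-at-max {m} (x ∷ xs) (here refl) _ | no x≢m = ⊥-elim (x≢m refl)
split-at-max {m} (x ∷ xs) (there m∈xs) (x≤m ∷ xs≤m) | no x≢m
  with split-at-max xs m∈xs xs≤m
... | α , β , refl , α<m , β≤m = x ∷ α , β , refl , ≤∧≢⇒< x≤m x≢m ∷ α<m , β≤m

length-split : ∀ {k} (α : List ℕ) m β → length (α ++ m ∷ β) ≤ k →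
  Σ ℕ λ k′ → k ≡ suc k′ × length α ≤ k′ × length β ≤ k′
length-split α m β len
  rewrite length-++ α {m ∷ β} | +-suc (length α) (length β) with len
... | s≤s len′ = _ , refl , m+n≤o⇒m≤o (length α) len′ , m+n≤o⇒n≤o (length α) len′

data MaxSplit : List ℕ → Set where
  []    : MaxSplit []
  split : ∀ {α m β} → All (_< m) α → All (_≤ m) β →
          MaxSplit α → MaxSplit β → MaxSplit (α ++ m ∷ β)

maxSplit : ∀ l → MaxSplit l
maxSplit l = go (length l) l ≤-refl
  where
  go : ∀ k l → length l ≤ k → MaxSplit l
  go k [] _ = []
  go k (x ∷ xs) len with split-at-max (x ∷ xs) (maxL-∈ x xs) (maxL-upper (x ∷ xs))
  ... | α , β , eq , α<m , β≤m with length-split α _ β (subst (λ l → length l ≤ k) eq len)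
  ...   | k′ , refl , lenα , lenβ =
    subst MaxSplit (sym eq) (split α<m β≤m (go k′ α lenα) (go k′ β lenβ))

inord : Tree → List ℕ
inord leaf         = []
inord (node l x r) = inord l ++ x ∷ inord r

post : Tree → List ℕ
post leaf         = []
post (node l x r) = post l ++ post r ++ [ x ]

Tin′-[] : ∀ k → Tin′ k [] ≡ leaf
Tin′-[] zero    = refl
Tin′-[] (suc k) = refl

S′-[] : ∀ k → S′ k [] ≡ []
S′-[] zero    = refl
S′-[] (suc k) = refl

Tin′-∷ : ∀ k x xs {m α β} → maxL (x ∷ xs) ≡ m → breakAt m (x ∷ xs) ≡ (α , β) →
  Tin′ (suc k) (x ∷ xs) ≡ node (Tin′ k α) m (Tin′ k β)
Tin′-∷ k x xs refl eq rewrite eq = refl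

S′-∷ : ∀ k x xs {m α β} → maxL (x ∷ xs) ≡ m → breakAt m (x ∷ xs) ≡ (α , β) →
  S′ (suc k) (x ∷ xs) ≡ S′ k α ++ S′ k β ++ [ m ]
S′-∷ k x xs refl eq rewrite eq = refl

Tin′-split : ∀ k {α m β} → All (_< m) α → All (_≤ m) β →
  Tin′ (suc k) (α ++ m ∷ β) ≡ node (Tin′ k α) m (Tin′ k β)
Tin′-split k {[]}    {m} {β} α<m β≤m =
  Tin′-∷ k m β (maxL-split [] β α<m β≤m) (breakAt-split [] β [])
Tin′-split k {x ∷ α} {m} {β} α<m β≤m =
  Tin′-∷ k x (α ++ m ∷ β) (maxL-split (x ∷ α) β α<m β≤m) (breakAt-split (x ∷ α) β (All.map <⇒≢ α<m))

S′-split : ∀ k {α m β} → All (_< m) α → All (_≤ m) β →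
  S′ (suc k) (α ++ m ∷ β) ≡ S′ k α ++ S′ k β ++ [ m ]
S′-split k {[]}    {m} {β} α<m β≤m =
  S′-∷ k m β (maxL-split [] β α<m β≤m) (breakAt-split [] β [])
S′-split k {x ∷ α} {m} {β} α<m β≤m =
  S′-∷ k x (α ++ m ∷ β) (maxL-split (x ∷ α) β α<m β≤m) (breakAt-split (x ∷ α) β (All.map <⇒≢ α<m))

Tin′-stable : ∀ {l j k} → MaxSplit l → length l ≤ j → length l ≤ k → Tin′ j l ≡ Tin′ k l
Tin′-stable {j = j} {k} [] _ _ = trans (Tin′-[] j) (sym (Tin′-[] k))
Tin′-stable (split {α} {m} {β} α<m β≤m sα sβ) lenj lenk
  with length-split α m β lenj | length-split α m β lenk
... | j′ , refl , lenαj , lenβj | k′ , refl , lenαk , lenβk = begin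
  Tin′ (suc j′) (α ++ m ∷ β)           ≡⟨ Tin′-split j′ α<m β≤m ⟩
  node (Tin′ j′ α) m (Tin′ j′ β)       ≡⟨ cong₂ (λ a b → node a m b)
                                            (Tin′-stable sα lenαj lenαk) (Tin′-stable sβ lenβj lenβk) ⟩
  node (Tin′ k′ α) m (Tin′ k′ β)       ≡⟨ Tin′-split k′ α<m β≤m ⟨
  Tin′ (suc k′) (α ++ m ∷ β)           ∎
  where open ≡-Reasoning

Tin-split : ∀ {α m β} → All (_< m) α → All (_≤ m) β → Tin (α ++ m ∷ β) ≡ node (Tin α) m (Tin β)
Tin-split {α} {m} {β} α<m β≤m with length-split α m β ≤-refl
... | k , len≡ , lenα , lenβ = begin
  Tin′ (length (α ++ m ∷ β)) (α ++ m ∷ β) ≡⟨ cong (λ j → Tin′ j (α ++ m ∷ β)) len≡ ⟩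
  Tin′ (suc k) (α ++ m ∷ β)               ≡⟨ Tin′-split k α<m β≤m ⟩
  node (Tin′ k α) m (Tin′ k β)            ≡⟨ cong₂ (λ a b → node a m b)
                                               (Tin′-stable (maxSplit α) lenα ≤-refl)
                                               (Tin′-stable (maxSplit β) lenβ ≤-refl) ⟩
  node (Tin α) m (Tin β)                  ∎
  where open ≡-Reasoning

S≡post∘Tin : ∀ l → S l ≡ post (Tin l)
S≡post∘Tin l = go (maxSplit l) ≤-refl
  where
  go : ∀ {l k} → MaxSplit l → length l ≤ k → S′ k l ≡ post (Tin′ k l)
  go {k = k} [] _ rewrite Tin′-[] k = S′-[] k
  go (split {α} {m} {β} α<m β≤m sα sβ) len with length-split α m β len
  ... | k , refl , lenα , lenβ
    rewrite S′-split k α<m β≤m | Tin′-split k α<m β≤m | go sα lenα | go sβ lenβ = refl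

inord-Tin : ∀ l → inord (Tin l) ≡ l
inord-Tin l = go (maxSplit l)
  where
  go : ∀ {l} → MaxSplit l → inord (Tin l) ≡ l
  go []                      = refl
  go (split α<m β≤m sα sβ) rewrite Tin-split α<m β≤m | go sα | go sβ = refl

Decreasing : Tree → Set
Decreasing leaf         = ⊤
Decreasing (node l x r) = All (_< x) (inord l) × All (_< x) (inord r) × Decreasing l × Decreasing r

Tin-inord : ∀ {T} → Decreasing T → Tin (inord T) ≡ T
Tin-inord {leaf}       _                     = refl
Tin-inord {node l x r} (l<x , r<x , dl , dr) =
  trans (Tin-split l<x (All.map <⇒≤ r<x)) (cong₂ (λ a b → node a x b) (Tin-inord dl) (Tin-inord dr))

Unique-++⁻ : ∀ {A : Set} (u : List A) {v} → Unique (u ++ v) → Unique u × Unique v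
Unique-++⁻ []      uv          = [] , uv
Unique-++⁻ (x ∷ u) (x∉uv ∷ uv) =
  AllP.++⁻ˡ u x∉uv ∷ proj₁ (Unique-++⁻ u uv) , proj₂ (Unique-++⁻ u uv)

Tin-decreasing : ∀ {l} → Unique l → Decreasing (Tin l)
Tin-decreasing {l} = go (maxSplit l)
  where
  go : ∀ {l} → MaxSplit l → Unique l → Decreasing (Tin l)
  go [] _ = tt
  go (split {α} {m} {β} α<m β≤m sα sβ) u with Unique-++⁻ α {m ∷ β} u
  ... | uα , m∉β ∷ uβ rewrite Tin-split α<m β≤m | inord-Tin α | inord-Tin β =
    α<m , All.zipWith (λ (x≤m , m≢x) → ≤∧≢⇒< x≤m (m≢x ∘ sym)) (β≤m , m∉β) , go sα uα , go sβ uβ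

post↭inord : ∀ T → post T ↭ inord T
post↭inord leaf         = ↭-refl
post↭inord (node l x r) = PP.++⁺ (post↭inord l)
  (↭-trans (PP.++⁺ʳ [ x ] (post↭inord r)) (↭-sym (PP.∷↭∷ʳ x (inord r))))

S↭ : ∀ l → S l ↭ l
S↭ l = subst₂ _↭_ (sym (S≡post∘Tin l)) (inord-Tin l) (post↭inord (Tin l))

mapLabels : (ℕ → ℕ) → Tree → Tree
mapLabels f leaf         = leaf
mapLabels f (node l x r) = node (mapLabels f l) (f x) (mapLabels f r)

inord-mapLabels : ∀ f T → inord (mapLabels f T) ≡ map f (inord T)
inord-mapLabels f leaf         = refl
inord-mapLabels f (node l x r) = begin
  inord (mapLabels f l) ++ f x ∷ inord (mapLabels f r)
    ≡⟨ cong₂ (λ a b → a ++ f x ∷ b) (inord-mapLabels f l) (inord-mapLabels f r) ⟩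
  map f (inord l) ++ f x ∷ map f (inord r)
    ≡⟨ map-++ f (inord l) (x ∷ inord r) ⟨
  map f (inord l ++ x ∷ inord r) ∎
  where open ≡-Reasoning

post-mapLabels : ∀ f T → post (mapLabels f T) ≡ map f (post T)
post-mapLabels f leaf         = refl
post-mapLabels f (node l x r) = begin
  post (mapLabels f l) ++ post (mapLabels f r) ++ [ f x ]
    ≡⟨ cong₂ (λ a b → a ++ b ++ [ f x ]) (post-mapLabels f l) (post-mapLabels f r) ⟩
  map f (post l) ++ map f (post r) ++ map f [ x ]
    ≡⟨ cong (map f (post l) ++_) (map-++ f (post r) [ x ]) ⟨
  map f (post l) ++ map f (post r ++ [ x ])
    ≡⟨ map-++ f (post l) (post r ++ [ x ]) ⟨
  map f (post l ++ post r ++ [ x ]) ∎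
  where open ≡-Reasoning

mapLabels-id-local : ∀ {f} T → All (λ x → f x ≡ x) (inord T) → mapLabels f T ≡ T
mapLabels-id-local leaf         _  = refl
mapLabels-id-local (node l x r) fx≡x with AllP.++⁻ˡ (inord l) fx≡x | AllP.++⁻ʳ (inord l) fx≡x
... | on-l | fx≡x′ ∷ on-r
  rewrite mapLabels-id-local l on-l | fx≡x′ | mapLabels-id-local r on-r = refl

mapLabels-∘ : ∀ g f T → mapLabels g (mapLabels f T) ≡ mapLabels (g ∘ f) T
mapLabels-∘ g f leaf         = refl
mapLabels-∘ g f (node l x r) = cong₂ (λ a b → node a (g (f x)) b) (mapLabels-∘ g f l) (mapLabels-∘ g f r)

-- For unique f ∘ l this amounts to T_in(f ∘ l) = f(T_in(l)).
DecreasingUnder : (ℕ → ℕ) → List ℕ → Set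
DecreasingUnder f l = Decreasing (mapLabels f (Tin l))

DecreasingUnder-split : ∀ {f α m β} → All (_< m) α → All (_≤ m) β →
  DecreasingUnder f (α ++ m ∷ β) ⇔
  (All (λ x → f x < f m) α × All (λ x → f x < f m) β × DecreasingUnder f α × DecreasingUnder f β)
DecreasingUnder-split {f} {α} {m} {β} α<m β≤m
  rewrite Tin-split α<m β≤m | inord-mapLabels f (Tin α) | inord-mapLabels f (Tin β)
        | inord-Tin α | inord-Tin β =
  mk⇔ (λ (fα<fm , fβ<fm , dα , dβ) → AllP.map⁻ fα<fm , AllP.map⁻ fβ<fm , dα , dβ)
      (λ (fα<fm , fβ<fm , dα , dβ) → AllP.map⁺ fα<fm , AllP.map⁺ fβ<fm , dα , dβ)

++-∷-≡-++ : ∀ {A : Set} (α : List A) {m β} u {v} → α ++ m ∷ β ≡ u ++ v →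
  (∃ λ β₁ → u ≡ α ++ m ∷ β₁ × β ≡ β₁ ++ v) ⊎ (∃ λ α₂ → α ≡ u ++ α₂ × v ≡ α₂ ++ m ∷ β)
++-∷-≡-++ []      []      eq = inj₂ ([] , refl , sym eq)
++-∷-≡-++ []      (x ∷ u) eq with ∷-injective eq
... | refl , β≡ = inj₁ (u , refl , β≡)
++-∷-≡-++ (a ∷ α) []      eq = inj₂ (a ∷ α , refl , sym eq)
++-∷-≡-++ (a ∷ α) (x ∷ u) eq with ∷-injective eq
... | refl , eq′ with ++-∷-≡-++ α u eq′
...   | inj₁ (β₁ , refl , β≡) = inj₁ (β₁ , refl , β≡)
...   | inj₂ (α₂ , refl , v≡) = inj₂ (α₂ , refl , v≡)

DecreasingUnder-++⁻ : ∀ {f} u v → DecreasingUnder f (u ++ v) → DecreasingUnder f u × DecreasingUnder f v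
DecreasingUnder-++⁻ {f} u v = go (maxSplit (u ++ v)) u refl
  where
  go : ∀ {l} → MaxSplit l → ∀ u {v} → l ≡ u ++ v → DecreasingUnder f l →
       DecreasingUnder f u × DecreasingUnder f v
  go []  []      refl d = d , d
  go (split {α} {m} {β} α<m β≤m sα sβ) u eq d
    with Equivalence.to (DecreasingUnder-split α<m β≤m) d | ++-∷-≡-++ α u eq
  ... | fα<fm , fβ<fm , dα , dβ | inj₁ (β₁ , refl , refl) =
    let dβ₁ , dv = go sβ β₁ refl dβ
    in  Equivalence.from (DecreasingUnder-split α<m (AllP.++⁻ˡ β₁ β≤m))
          (fα<fm , AllP.++⁻ˡ β₁ fβ<fm , dα , dβ₁) , dv
  ... | fα<fm , fβ<fm , dα , dβ | inj₂ (α₂ , refl , refl) =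
    let du , dα₂ = go sα u refl dα
    in  du , Equivalence.from (DecreasingUnder-split (AllP.++⁻ʳ u α<m) β≤m)
               (AllP.++⁻ʳ u fα<fm , fβ<fm , dα₂ , dβ)

-- T_in(post T) is y above T_in(post l ++ post r), and DecreasingUnder-++⁻ hands that down to l and r.
decreasing-mapLabels : ∀ {f} T → Decreasing T → DecreasingUnder f (post T) → Decreasing (mapLabels f T)
decreasing-mapLabels leaf _ _ = tt
decreasing-mapLabels {f} (node l y r) (l<y , r<y , dl , dr) d
  with Equivalence.to (DecreasingUnder-split post-below []) d′
  where
  post-below : All (_< y) (post l ++ post r)
  post-below = AllP.++⁺ (PP.All-resp-↭ (↭-sym (post↭inord l)) l<y)
                        (PP.All-resp-↭ (↭-sym (post↭inord r)) r<y)
  d′ : DecreasingUnder f ((post l ++ post r) ++ [ y ])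
  d′ = subst (DecreasingUnder f) (sym (++-assoc (post l) (post r) [ y ])) d
... | fpost<fy , [] , dpost , _ with DecreasingUnder-++⁻ (post l) (post r) dpost
...   | dpl , dpr rewrite inord-mapLabels f l | inord-mapLabels f r =
  AllP.map⁺ (PP.All-resp-↭ (post↭inord l) (AllP.++⁻ˡ (post l) fpost<fy)) ,
  AllP.map⁺ (PP.All-resp-↭ (post↭inord r) (AllP.++⁻ʳ (post l) fpost<fy)) ,
  decreasing-mapLabels l dl dpl , decreasing-mapLabels r dr dpr

Tin-map-from-S : ∀ {f θ} → Unique θ → Unique (map f (S θ)) →
  Tin (map f (S θ)) ≡ mapLabels f (Tin (S θ)) → Tin (map f θ) ≡ mapLabels f (Tin θ)
Tin-map-from-S {f} {θ} uθ ufSθ Tin-fSθ = begin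
  Tin (map f θ)                       ≡⟨ cong (Tin ∘ map f) (inord-Tin θ) ⟨
  Tin (map f (inord (Tin θ)))         ≡⟨ cong Tin (inord-mapLabels f (Tin θ)) ⟨
  Tin (inord (mapLabels f (Tin θ)))   ≡⟨ Tin-inord (decreasing-mapLabels (Tin θ) (Tin-decreasing uθ) d) ⟩
  mapLabels f (Tin θ)                 ∎
  where
  open ≡-Reasoning
  d : DecreasingUnder f (post (Tin θ))
  d = subst (DecreasingUnder f) (S≡post∘Tin θ) (subst Decreasing Tin-fSθ (Tin-decreasing ufSθ))

S-map : ∀ {f θ} → Tin (map f θ) ≡ mapLabels f (Tin θ) → S (map f θ) ≡ map f (S θ)
S-map {f} {θ} Tin-fθ = begin
  S (map f θ)                  ≡⟨ S≡post∘Tin (map f θ) ⟩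
  post (Tin (map f θ))         ≡⟨ cong post Tin-fθ ⟩
  post (mapLabels f (Tin θ))   ≡⟨ post-mapLabels f (Tin θ) ⟩
  map f (post (Tin θ))         ≡⟨ cong (map f) (S≡post∘Tin θ) ⟨
  map f (S θ)                  ∎
  where open ≡-Reasoning

Tin-map-inverse : ∀ {f g l} → All (λ x → g (f x) ≡ x) l →
  Tin (map f l) ≡ mapLabels f (Tin l) → Tin (map g (map f l)) ≡ mapLabels g (Tin (map f l))
Tin-map-inverse {f} {g} {l} gf≡id Tin-fl = begin
  Tin (map g (map f l))             ≡⟨ cong Tin (trans (sym (map-∘ l)) (map-id-local gf≡id)) ⟩
  Tin l                             ≡⟨ mapLabels-id-local (Tin l) (subst (All _) (sym (inord-Tin l)) gf≡id) ⟨
  mapLabels (g ∘ f) (Tin l)         ≡⟨ mapLabels-∘ g f (Tin l) ⟨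
  mapLabels g (mapLabels f (Tin l)) ≡⟨ cong (mapLabels g) Tin-fl ⟨
  mapLabels g (Tin (map f l))       ∎
  where open ≡-Reasoning

∈-[1‥]⁻ : ∀ {n x} → x ∈ [1‥ n ] → Σ ℕ λ i → x ≡ suc i × i < n
∈-[1‥]⁻ x∈ with ∈-map⁻ suc x∈
... | i , i∈ , refl = i , refl , ∈-upTo⁻ i∈

IsPerm-Unique : ∀ {n l} → IsPerm n l → Unique l
IsPerm-Unique {n} l↭ = Unique-resp-↭ (↭⇒↭ₛ (↭-sym l↭)) (UP.map⁺ suc-injective (UP.upTo⁺ n))

IsPerm-length : ∀ {n l} → IsPerm n l → length l ≡ n
IsPerm-length {n} l↭ = trans (PP.↭-length l↭) (trans (length-map suc (upTo n)) (length-upTo n))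

IsPerm-S : ∀ {n θ} → IsPerm n θ → IsPerm n (S θ)
IsPerm-S {θ = θ} θ↭ = ↭-trans (S↭ θ) θ↭

IsPerm-map : ∀ {n f θ} → map f [1‥ n ] ↭ [1‥ n ] → IsPerm n θ → IsPerm n (map f θ)
IsPerm-map {f = f} f↭ θ↭ = ↭-trans (PP.map⁺ f θ↭) f↭

map-app-[1‥] : ∀ {n} l → IsPerm n l → map (app l) [1‥ n ] ≡ l
map-app-[1‥] l l↭ rewrite sym (IsPerm-length l↭) =
  trans (sym (map-∘ (upTo (length l)))) (trans (map-upTo (at l) (length l)) (applyUpTo-at l))
  where
  applyUpTo-at : ∀ l → applyUpTo (at l) (length l) ≡ l
  applyUpTo-at []       = refl
  applyUpTo-at (x ∷ xs) = cong (x ∷_) (applyUpTo-at xs)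

IsPerm-∘ₚ : ∀ {n λ′ θ} → IsPerm n λ′ → IsPerm n θ → IsPerm n (λ′ ∘ₚ θ)
IsPerm-∘ₚ {λ′ = λ′} λ′↭ = IsPerm-map (subst (_↭ _) (sym (map-app-[1‥] λ′ λ′↭)) λ′↭)

indexOf : ℕ → List ℕ → ℕ
indexOf y []       = 0
indexOf y (x ∷ xs) with x ≟ y
... | yes _ = 0
... | no  _ = suc (indexOf y xs)

at-indexOf : ∀ {y} l → y ∈ l → at l (indexOf y l) ≡ y
at-indexOf {y} (x ∷ xs) y∈ with x ≟ y | y∈
... | yes x≡y | _           = x≡y
... | no  x≢y | here y≡x    = ⊥-elim (x≢y (sym y≡x))
... | no  _   | there y∈xs = at-indexOf xs y∈xs

at-∈ : ∀ l {i} → i < length l → at l i ∈ l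
at-∈ (x ∷ xs) {zero}  _         = here refl
at-∈ (x ∷ xs) {suc i} (s≤s i<) = there (at-∈ xs i<)

indexOf-at : ∀ l {i} → Unique l → i < length l → indexOf (at l i) l ≡ i
indexOf-at (x ∷ xs) {zero} _ _ with x ≟ x
... | yes _   = refl
... | no  x≢x = ⊥-elim (x≢x refl)
indexOf-at (x ∷ xs) {suc i} (x∉xs ∷ u) (s≤s i<) with x ≟ at xs i
... | yes x≡ = ⊥-elim (All.lookup x∉xs (at-∈ xs i<) x≡)
... | no  _  = cong suc (indexOf-at xs u i<)

-- One-based like app; junk value length λ′ + 1 when y ∉ λ′.
inverse : List ℕ → ℕ → ℕ
inverse λ′ y = suc (indexOf y λ′)

inverse-app : ∀ {n λ′ x} → IsPerm n λ′ → x ∈ [1‥ n ] → inverse λ′ (app λ′ x) ≡ x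
inverse-app {λ′ = λ′} λ′↭ x∈ with ∈-[1‥]⁻ x∈
... | i , refl , i<n =
  cong suc (indexOf-at λ′ (IsPerm-Unique λ′↭) (subst (i <_) (sym (IsPerm-length λ′↭)) i<n))

inverse-∘ₚ : ∀ {n λ′ θ} → IsPerm n λ′ → IsPerm n θ → map (inverse λ′) (λ′ ∘ₚ θ) ≡ θ
inverse-∘ₚ {θ = θ} λ′↭ θ↭ =
  trans (sym (map-∘ θ)) (map-id-local (All.tabulate (inverse-app λ′↭ ∘ PP.∈-resp-↭ θ↭)))

∘ₚ-inverse : ∀ {n λ′ θ} → IsPerm n λ′ → IsPerm n θ → λ′ ∘ₚ map (inverse λ′) θ ≡ θ
∘ₚ-inverse {λ′ = λ′} {θ} λ′↭ θ↭ = trans (sym (map-∘ θ))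
  (map-id-local (All.tabulate (at-indexOf λ′ ∘ PP.∈-resp-↭ (↭-sym λ′↭) ∘ PP.∈-resp-↭ θ↭)))

IsPerm-inverse : ∀ {n λ′ θ} → IsPerm n λ′ → IsPerm n θ → IsPerm n (map (inverse λ′) θ)
IsPerm-inverse {n} {λ′} λ′↭ = IsPerm-map (↭-trans (PP.map⁺ (inverse λ′) (↭-sym λ′↭))
  (↭-reflexive (trans (cong (map (inverse λ′)) (sym (map-app-[1‥] λ′ λ′↭)))
                      (inverse-∘ₚ λ′↭ (↭-refl {x = [1‥ n ]})))))

∘ₚ-injective : ∀ {n λ′ θ₁ θ₂} → IsPerm n λ′ → IsPerm n θ₁ → IsPerm n θ₂ →
  λ′ ∘ₚ θ₁ ≡ λ′ ∘ₚ θ₂ → θ₁ ≡ θ₂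
∘ₚ-injective {λ′ = λ′} λ′↭ θ₁↭ θ₂↭ eq =
  trans (sym (inverse-∘ₚ λ′↭ θ₁↭)) (trans (cong (map (inverse λ′)) eq) (inverse-∘ₚ λ′↭ θ₂↭))

⟦⟧-++ : ∀ w v θ → ⟦ w ++ v ⟧ θ ≡ ⟦ w ⟧ (⟦ v ⟧ θ)
⟦⟧-++ []      v θ = refl
⟦⟧-++ (o ∷ w) v θ = cong ⟦ o ⟧ₒ (⟦⟧-++ w v θ)

relabel≡mapLabels : ∀ λ′ T → relabel λ′ T ≡ mapLabels (app λ′) T
relabel≡mapLabels λ′ leaf         = refl
relabel≡mapLabels λ′ (node l x r) =
  cong₂ (λ a b → node a (app λ′ x) b) (relabel≡mapLabels λ′ l) (relabel≡mapLabels λ′ r)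

RespectsAt-S : ∀ {w n π ρ λ′} → IsPerm n λ′ → RespectsAt w n π ρ λ′ → RespectsAt (w ++ [ opS ]) n π ρ λ′
RespectsAt-S {w} {n} {π} {ρ} {λ′} λ′↭ (image , _ , _ , preimage) =
  image′ ,
  (λ θ θ↭ θ↦π → IsPerm-∘ₚ λ′↭ θ↭ , proj₁ (image′ θ θ↭ θ↦π)) ,
  (λ θ₁ θ₂ θ₁↭ _ θ₂↭ _ → ∘ₚ-injective λ′↭ θ₁↭ θ₂↭) ,
  preimage′
  where
  A∘S : ∀ θ → ⟦ w ++ [ opS ] ⟧ θ ≡ ⟦ w ⟧ (S θ)
  A∘S = ⟦⟧-++ w [ opS ]

  image′ : ∀ θ → IsPerm n θ → ⟦ w ++ [ opS ] ⟧ θ ≡ π →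
    ⟦ w ++ [ opS ] ⟧ (λ′ ∘ₚ θ) ≡ ρ × Tin (λ′ ∘ₚ θ) ≡ relabel λ′ (Tin θ)
  image′ θ θ↭ θ↦π = (begin
      ⟦ w ++ [ opS ] ⟧ (λ′ ∘ₚ θ) ≡⟨ A∘S (λ′ ∘ₚ θ) ⟩
      ⟦ w ⟧ (S (λ′ ∘ₚ θ))         ≡⟨ cong ⟦ w ⟧ (S-map Tin-λθ) ⟩
      ⟦ w ⟧ (λ′ ∘ₚ S θ)           ≡⟨ proj₁ (image-Sθ) ⟩
      ρ                          ∎) ,
    trans Tin-λθ (sym (relabel≡mapLabels λ′ (Tin θ)))
    where
    open ≡-Reasoning
    image-Sθ = image (S θ) (IsPerm-S θ↭) (trans (sym (A∘S θ)) θ↦π)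
    Tin-λθ : Tin (λ′ ∘ₚ θ) ≡ mapLabels (app λ′) (Tin θ)
    Tin-λθ = Tin-map-from-S (IsPerm-Unique θ↭) (IsPerm-Unique (IsPerm-∘ₚ λ′↭ (IsPerm-S θ↭)))
      (trans (proj₂ image-Sθ) (relabel≡mapLabels λ′ (Tin (S θ))))

  preimage′ : ∀ θ′ → IsPerm n θ′ → ⟦ w ++ [ opS ] ⟧ θ′ ≡ ρ →
    Σ (List ℕ) λ θ → IsPerm n θ × ⟦ w ++ [ opS ] ⟧ θ ≡ π × λ′ ∘ₚ θ ≡ θ′
  preimage′ θ′ θ′↭ θ′↦ρ with preimage (S θ′) (IsPerm-S θ′↭) (trans (sym (A∘S θ′)) θ′↦ρ)
  ... | σ , σ↭ , σ↦π , λσ≡Sθ′ =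
    map g θ′ , IsPerm-inverse λ′↭ θ′↭ ,
    trans (A∘S (map g θ′)) (trans (cong ⟦ w ⟧ S-gθ′) σ↦π) ,
    ∘ₚ-inverse λ′↭ θ′↭
    where
    g = inverse λ′
    gSθ′≡σ : map g (S θ′) ≡ σ
    gSθ′≡σ = trans (cong (map g) (sym λσ≡Sθ′)) (inverse-∘ₚ λ′↭ σ↭)
    Tin-gSθ′ : Tin (map g (S θ′)) ≡ mapLabels g (Tin (S θ′))
    Tin-gSθ′ = subst (λ l → Tin (map g l) ≡ mapLabels g (Tin l)) λσ≡Sθ′
      (Tin-map-inverse (All.tabulate (inverse-app λ′↭ ∘ PP.∈-resp-↭ σ↭))
        (trans (proj₂ (image σ σ↭ σ↦π)) (relabel≡mapLabels λ′ (Tin σ))))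
    S-gθ′ : S (map g θ′) ≡ σ
    S-gθ′ = trans (S-map (Tin-map-from-S (IsPerm-Unique θ′↭)
                     (subst Unique (sym gSθ′≡σ) (IsPerm-Unique σ↭)) Tin-gSθ′)) gSθ′≡σ

proposition4p6 : (w : List Op) → Respects w → Respects (w ++ [ opS ])
proposition4p6 w respects n π π↭ π-av (θ , θ↭ , θ↦π) ρ Pπρ λ′ λ′↭ λ′π≡ρ =
  RespectsAt-S {w} λ′↭
    (respects n π π↭ π-av (S θ , IsPerm-S θ↭ , trans (sym (⟦⟧-++ w [ opS ] θ)) θ↦π) ρ Pπρ λ′ λ′↭ λ′π≡ρ)
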